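{- Let $T$ be a meet$_\omega$-simulation from an L$_1$-model $\mathfrak{M}=(W,1,\curlywedge,V)$ to an L$_1$-model $\mathfrak{M}'=(W',1',\curlywedge',V')$. Then for each $(X,w')\in T$ and every $\phi\in\mathcal{L}$: if $\mathfrak{M},w\Vdash\phi$ for all $w\in X$, then $\mathfrak{M}',w'\Vdash\phi$.
   Context: $\mathcal{L}$ is generated by $\phi ::= p\mid\top\mid\bot\mid\phi\wedge\phi\mid\phi\vee\phi$, $p$ in a fixed set $\mathrm{Prop}$. A meet-semilattice $(W,1,\curlywedge)$ is a poset in which every finite subset has a meet; $\curlywedge$ binary meet, $1$ top, $w\preccurlyeq v$ iff $w\curlywedge v=w$. A filter is a $\preccurlyeq$-upward closed subset closed under finite meets. An L$_1$-model $(W,1,\curlywedge,V)$ is a meet-semilattice with $V(p)$ a filter for each $p$. Satisfaction: $w\Vdash p$ iff $w\in V(p)$; $w\Vdash\top$ always; $w\Vdash\bot$ iff $w=1$; $\wedge$ classical; $w\Vdash\phi_1\vee\phi_2$ iff there are $u,v$ with $u\curlywedge v\preccurlyeq w$, $u\Vdash\phi_1$, $v\Vdash\phi_2$. Let $\mathcal{P}_\omega W$ denote the set of finite subsets of $W$. A meet$_\omega$-simulation from $\mathfrak{M}$ to $\mathfrak{M}'$ is a relation $T\subseteq\mathcal{P}_\omega W\times W'$ such that for all $(X,w')\in T$: (M'1) if $w\in V(p)$ for all $w\in X$, then $w'\in V'(p)$, for each $p\in\mathrm{Prop}$; (M'2) if $w=1$ for all $w\in X$, then $w'=1'$; (M'3)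 if for each $w\in X$ elements $u_w,v_w\in W$ satisfy $u_w\curlywedge v_w\preccurlyeq w$, then there exist $v',u'\in W'$ with $(\{u_w\mid w\in X\},u')\in T$, $(\{v_w\mid w\in X\},v')\in T$ and $v'\curlywedge'u'\preccurlyeq'w'$. -}

module Defs where

open import Level using (Level; _⊔_; suc)
open import Data.List using (List)
open import Data.List.Membership.Propositional using (_∈_; mapWith∈)
open import Data.List.Relation.Unary.All using (All)
open import Data.Product using (Σ; ∃; _×_; _,_)
open import Relation.Binary.PropositionalEquality using (_≡_)

data Form {p} (Prop : Set p) : Set p where
  var  : Prop → Form Prop
  ⊤ᶠ   : Form Prop
  ⊥ᶠ   : Form Prop
  _∧ᶠ_ : Form Prop → Form Prop → Form Prop
  _∨ᶠ_ : Form Prop → Form Prop → Form Prop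

record MeetSemilattice a : Set (suc a) where
  field
    W      : Set a
    one    : W
    _⋏_    : W → W → W
    ⋏-assoc : ∀ x y z → (x ⋏ y) ⋏ z ≡ x ⋏ (y ⋏ z)
    ⋏-comm  : ∀ x y → x ⋏ y ≡ y ⋏ x
    ⋏-idem  : ∀ x → x ⋏ x ≡ x
    ⋏-one   : ∀ x → x ⋏ one ≡ x

  _≼_ : W → W → Set a
  w ≼ v = w ⋏ v ≡ w

record IsFilter {a} (S : MeetSemilattice a) (F : MeetSemilattice.W S → Set a) : Set a where
  open MeetSemilattice S
  field
    up      : ∀ {w v} → w ≼ v → F w → F v
    has-one : F one
    meet    : ∀ {w v} → F w → F v → F (w ⋏ v)

record L1Model {p} a (Prop : Set p) : Set (suc a ⊔ p) where
  field
    sl : MeetSemilattice a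
  open MeetSemilattice sl public
  field
    V     : Prop → W → Set a
    V-fil : ∀ q → IsFilter sl (V q)

module _ {p a} {Prop : Set p} (M : L1Model a Prop) where
  open L1Model M

  _⊩_ : W → Form Prop → Set (a ⊔ p)
  w ⊩ var q    = Level.Lift p (V q w)
  w ⊩ ⊤ᶠ       = Level.Lift (a ⊔ p) Data.Unit.⊤
    where import Data.Unit
  w ⊩ ⊥ᶠ       = Level.Lift p (w ≡ one)
  w ⊩ (φ ∧ᶠ ψ) = (w ⊩ φ) × (w ⊩ ψ)
  w ⊩ (φ ∨ᶠ ψ) = Σ W λ u → Σ W λ v → ((u ⋏ v) ≼ w) × (u ⊩ φ) × (v ⊩ ψ)

-- meet_ω-simulation; finite subsets of W represented by lists
module _ {p a b} {Prop : Set p} (M : L1Model a Prop) (M' : L1Model b Prop) where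
  private
    module M = L1Model M
    module M' = L1Model M'

  record IsMeetωSimulation {t} (T : List M.W → M'.W → Set t) : Set (a ⊔ b ⊔ t ⊔ p) where
    field
      M'1 : ∀ {X w'} → T X w' → ∀ q → All (M.V q) X → M'.V q w'
      M'2 : ∀ {X w'} → T X w' → All (_≡ M.one) X → w' ≡ M'.one
      M'3 : ∀ {X w'} → T X w' →
            (u v : ∀ {w} → w ∈ X → M.W) →
            (∀ {w} (w∈X : w ∈ X) → (u w∈X M.⋏ v w∈X) M.≼ w) →
            Σ M'.W λ v' → Σ M'.W λ u' →
              T (mapWith∈ X u) u' × T (mapWith∈ X v) v' × ((v' M'.⋏ u') M'.≼ w')

-- Every case is one clause of the simulation, read
-- pointwise over X: letters use (M'1), ⊥ uses (M'2), ∧ is immediate, and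
-- for φ ∨ ψ each w ∈ X comes with a split u_w ⋏ v_w ≼ w; (M'3) matches the
-- families {u_w} and {v_w} with worlds u', v' of M' covering w', to which
-- the induction hypothesis applies.
module Submission where

open import Defs
open import Level using (lift; lower)
open import Data.List using (List; []; _∷_)
open import Data.List.Relation.Unary.All as All using (All; []; _∷_)
open import Data.List.Membership.Propositional using (_∈_; mapWith∈)
open import Data.List.Relation.Unary.Any using (here; there)
open import Data.Product using (_,_; proj₁; proj₂)
open import Data.Unit using (tt)
open import Function using (_∘_)
open import Relation.Binary.PropositionalEquality using (refl; subst)

mapWith∈⁺ : ∀ {a b p} {A : Set a} {B : Set b} {P : B → Set p} (xs : List A)
            (f : ∀ {x} → x ∈ xs → B) →
            (∀ {x} (x∈xs : x ∈ xs) → P (f x∈xs)) → All P (mapWith∈ xs f)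
mapWith∈⁺ []       f Pf = []
mapWith∈⁺ (x ∷ xs) f Pf = Pf (here refl) ∷ mapWith∈⁺ xs (f ∘ there) (Pf ∘ there)

module _ {a} (S : MeetSemilattice a) where
  open MeetSemilattice S

  ⋏-comm-≼ : ∀ {u v w} → (v ⋏ u) ≼ w → (u ⋏ v) ≼ w
  ⋏-comm-≼ {u} {v} {w} = subst (_≼ w) (⋏-comm v u)

module _ {p a} {Prop : Set p} (M : L1Model a Prop) {φ ψ : Form Prop} {w : L1Model.W M} where
  open L1Model M

  ∨-left ∨-right : _⊩_ M w (φ ∨ᶠ ψ) → W
  ∨-left  (u , _) = u
  ∨-right (_ , v , _) = v

  ∨-covers : (d : _⊩_ M w (φ ∨ᶠ ψ)) → (∨-left d ⋏ ∨-right d) ≼ w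
  ∨-covers (_ , _ , u⋏v≼w , _) = u⋏v≼w

  ∨-left-⊩ : (d : _⊩_ M w (φ ∨ᶠ ψ)) → _⊩_ M (∨-left d) φ
  ∨-left-⊩ (_ , _ , _ , u⊩φ , _) = u⊩φ

  ∨-right-⊩ : (d : _⊩_ M w (φ ∨ᶠ ψ)) → _⊩_ M (∨-right d) ψ
  ∨-right-⊩ (_ , _ , _ , _ , v⊩ψ) = v⊩ψ

module _ {p a b t} {Prop : Set p} {M : L1Model a Prop} {M' : L1Model b Prop}
         {T : List (L1Model.W M) → L1Model.W M' → Set t}
         (sim : IsMeetωSimulation M M' T) where
  open IsMeetωSimulation sim

  simulation-preserves : ∀ {X w'} → T X w' → (φ : Form Prop) →
                         All (λ w → _⊩_ M w φ) X → _⊩_ M' w' φ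
  simulation-preserves TXw' (var q)  X⊩q = lift (M'1 TXw' q (All.map lower X⊩q))
  simulation-preserves TXw' ⊤ᶠ       _   = lift tt
  simulation-preserves TXw' ⊥ᶠ       X⊩⊥ = lift (M'2 TXw' (All.map lower X⊩⊥))
  simulation-preserves TXw' (φ ∧ᶠ ψ) X⊩φ∧ψ =
    simulation-preserves TXw' φ (All.map proj₁ X⊩φ∧ψ) ,
    simulation-preserves TXw' ψ (All.map proj₂ X⊩φ∧ψ)
  simulation-preserves {X} TXw' (φ ∨ᶠ ψ) X⊩φ∨ψ
    with M'3 TXw' (∨-left M ∘ split) (∨-right M ∘ split) (∨-covers M ∘ split)
    where split = All.lookup X⊩φ∨ψ
  ... | v' , u' , Tu' , Tv' , v'⋏u'≼w' =
    u' , v' , ⋏-comm-≼ (L1Model.sl M') v'⋏u'≼w' ,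
    simulation-preserves Tu' φ (mapWith∈⁺ X _ (∨-left-⊩ M ∘ All.lookup X⊩φ∨ψ)) ,
    simulation-preserves Tv' ψ (mapWith∈⁺ X _ (∨-right-⊩ M ∘ All.lookup X⊩φ∨ψ))

proposition8p3 : ∀ {p a b t} {Prop : Set p} (M : L1Model a Prop) (M' : L1Model b Prop)
                 (T : List (L1Model.W M) → L1Model.W M' → Set t) →
                 IsMeetωSimulation M M' T →
                 ∀ {X w'} → T X w' → (φ : Form Prop) →
                 All (λ w → _⊩_ M w φ) X → _⊩_ M' w' φ
proposition8p3 M M' T sim = simulation-preserves sim
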